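{- Let $G$ be a finite simple graph with clique partition number $\theta(G)=k$ and clique number $\omega=\omega(G)$. Then $\varphi(G)\leq \frac{k^2\omega}{2k-1}$.
   Context: A clique partition of $G$ is a partition of $V(G)$ into subsets each inducing a complete subgraph; $\theta(G)$ is the minimum number of parts in a clique partition (equivalently $\theta(G)=\chi(\overline{G})$). $\omega(G)$ is the largest order of a complete subgraph of $G$. A $b$-coloring of $G$ with $b$ colors is a proper coloring of $V(G)$ using exactly $b$ colors such that for every color $i$ there is a vertex of color $i$ having neighbors of all the other $b-1$ colors. The $b$-chromatic number $\varphi(G)$ is the largest $b$ for which such a coloring exists. -}

module Defs where

open import Data.Nat using (ℕ; _≤_)
open import Data.Fin using (Fin)
open import Data.Fin.Subset using (Subset; _∈_; ∣_∣)
open import Data.Product using (Σ; ∃; _×_)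
open import Relation.Nullary using (¬_; Dec)
open import Relation.Binary.PropositionalEquality using (_≡_; _≢_)
open import Level using (0ℓ)

record Graph (n : ℕ) : Set₁ where
  field
    Adj    : Fin n → Fin n → Set
    sym    : ∀ {u v} → Adj u v → Adj v u
    irrefl : ∀ {u} → ¬ Adj u u
    dec    : ∀ u v → Dec (Adj u v)
open Graph public

module _ {n : ℕ} (G : Graph n) where

  IsClique : Subset n → Set
  IsClique S = ∀ u v → u ∈ S → v ∈ S → u ≢ v → Adj G u v

  IsCliqueNumber : ℕ → Set
  IsCliqueNumber w =
    (Σ (Subset n) λ S → IsClique S × ∣ S ∣ ≡ w)
    × (∀ S → IsClique S → ∣ S ∣ ≤ w)

  IsCliquePartition : (k : ℕ) → (Fin n → Fin k) → Set
  IsCliquePartition k p =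
    (∀ i → ∃ λ v → p v ≡ i)
    × (∀ u v → p u ≡ p v → u ≢ v → Adj G u v)

  HasCliquePartition : ℕ → Set
  HasCliquePartition k = Σ (Fin n → Fin k) (IsCliquePartition k)

  IsCliquePartitionNumber : ℕ → Set
  IsCliquePartitionNumber k =
    HasCliquePartition k × (∀ j → HasCliquePartition j → k ≤ j)

  IsBColoring : (b : ℕ) → (Fin n → Fin b) → Set
  IsBColoring b c =
    (∀ u v → Adj G u v → c u ≢ c v)
    × (∀ i → ∃ λ v → c v ≡ i)
    × (∀ i → ∃ λ v → c v ≡ i
                 × (∀ j → j ≢ i → ∃ λ w → Adj G v w × c w ≡ j))

  HasBColoring : ℕ → Set
  HasBColoring b = Σ (Fin n → Fin b) (IsBColoring b)

  IsBChromaticNumber : ℕ → Set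
  IsBChromaticNumber b = HasBColoring b × (∀ b′ → HasBColoring b′ → b′ ≤ b)

{-# OPTIONS --safe #-}

-- Fix a b-vertex x i of every colour i and a partition of V(G) into k cliques, and call
-- colour i trivial when x i is its only vertex. A b-vertex has a neighbour of every other
-- colour, which for a trivial colour can only be its b-vertex; hence for every part ℓ the
-- b-vertices of the trivial colours together with the b-vertices lying in ℓ form a clique.
-- Summing over the parts, a trivial colour is counted k times and a nontrivial one once,
-- so k·t + (φ − t) ≤ kω where t is the number of trivial colours. The colour classes are
-- disjoint and nontrivial ones have at least two vertices, so t + 2(φ − t) ≤ n ≤ kω.
-- The first inequality plus k − 1 times the second gives (2k − 1)φ ≤ k²ω, because each
-- colour contributes exactly 2k − 1 to the left-hand side.

module Submission where

open import Defs hiding (sym)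
open import Data.Nat using (ℕ; zero; suc; _+_; _*_; _∸_; _≤_; z≤n; s≤s)
open import Data.Nat.Properties
  using (+-*-semiring; +-mono-≤; +-monoʳ-≤; *-monoʳ-≤; *-identityʳ; ≤-reflexive; ≤-trans; module ≤-Reasoning)
open import Data.Nat.Tactic.RingSolver using (solve-∀)
open import Data.Fin using (Fin; zero; suc; _≟_; punchIn)
open import Data.Fin.Properties using (any?; punchInᵢ≢i; punchIn-punchOut)
open import Data.Fin.Subset using (_∈_; ∣_∣)
open import Data.Vec using (tabulate)
open import Data.Vec.Properties using ([]=⇒lookup; lookup∘tabulate)
open import Data.Bool using (if_then_else_)
open import Data.Product using (∃; _×_; _,_; proj₁; proj₂)
open import Data.Sum using (_⊎_; inj₁; inj₂)
open import Data.Unit using (tt)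
open import Data.Empty using (⊥-elim)
open import Function using (_∘_)
open import Level using (0ℓ)
open import Relation.Nullary using (¬_; Dec; yes; no; does; contradiction)
open import Relation.Nullary.Decidable using (_×-dec_; _⊎-dec_; ¬?; dec-true)
open import Relation.Unary using (Pred; Decidable)
open import Relation.Binary.PropositionalEquality
  using (_≡_; _≢_; refl; sym; trans; cong; cong₂; subst; module ≡-Reasoning)
open import Algebra.Properties.Semiring.Sum +-*-semiring
  using (sum; sum-syntax; ∑-comm; ∑-distrib-+; *-distribˡ-sum; sum-cong-≗; sum-remove; sum-replicate-zero)

-- In the successor cases, k + (suc k + 0) is the normal form of 2 * suc k ∸ 1.
2*k∸1≡k+[k∸1] : ∀ k → 2 * k ∸ 1 ≡ k + (k ∸ 1)
2*k∸1≡k+[k∸1] zero    = refl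
2*k∸1≡k+[k∸1] (suc k) = identity k
  where
  identity : ∀ k → k + (suc k + 0) ≡ suc k + k
  identity = solve-∀

2*k∸1≤1+[k∸1]*2 : ∀ k → 2 * k ∸ 1 ≤ 1 + (k ∸ 1) * 2
2*k∸1≤1+[k∸1]*2 zero    = z≤n
2*k∸1≤1+[k∸1]*2 (suc k) = ≤-reflexive (identity k)
  where
  identity : ∀ k → k + (suc k + 0) ≡ 1 + k * 2
  identity = solve-∀

k*m+[k∸1]*[k*m]≡k*k*m : ∀ k m → k * m + (k ∸ 1) * (k * m) ≡ k * k * m
k*m+[k∸1]*[k*m]≡k*k*m zero    m = refl
k*m+[k∸1]*[k*m]≡k*k*m (suc k) m = identity k m
  where
  identity : ∀ k m → suc k * m + k * (suc k * m) ≡ suc k * suc k * m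
  identity = solve-∀

-- 𝟙 inspects only does, so 𝟙 (yes _ ×-dec d) reduces to 𝟙 d and 𝟙 (no _ ×-dec d) to 0.
𝟙 : ∀ {a} {A : Set a} → Dec A → ℕ
𝟙 a? = if does a? then 1 else 0

𝟙-holds : ∀ {a} {A : Set a} (a? : Dec A) → A → 𝟙 a? ≡ 1
𝟙-holds a? a rewrite dec-true a? a = refl

𝟙-fails : ∀ {a} {A : Set a} (a? : Dec A) → ¬ A → 𝟙 a? ≡ 0
𝟙-fails (yes a) ¬a = contradiction a ¬a
𝟙-fails (no _)  ¬a = refl

∑-mono-≤ : ∀ {m} {f g : Fin m → ℕ} → (∀ i → f i ≤ g i) → sum f ≤ sum g
∑-mono-≤ {zero}  f≤g = z≤n
∑-mono-≤ {suc m} f≤g = +-mono-≤ (f≤g zero) (∑-mono-≤ (f≤g ∘ suc))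

∑-const : ∀ m c → ∑[ i < m ] c ≡ m * c
∑-const zero    c = refl
∑-const (suc m) c = cong (c +_) (∑-const m c)

count : ∀ {m p} {P : Pred (Fin m) p} → Decidable P → ℕ
count P? = sum (𝟙 ∘ P?)

count-empty : ∀ {m p} {P : Pred (Fin m) p} (P? : Decidable P) → (∀ v → ¬ P v) → count P? ≡ 0
count-empty {m} P? ∅ = trans (sum-cong-≗ (λ v → 𝟙-fails (P? v) (∅ v))) (sum-replicate-zero m)

count-all : ∀ {m p} {P : Pred (Fin m) p} (P? : Decidable P) → (∀ v → P v) → count P? ≡ m
count-all {m} P? all = trans (sum-cong-≗ (λ v → 𝟙-holds (P? v) (all v))) (trans (∑-const m 1) (*-identityʳ m))

count-remove : ∀ {m p} {P : Pred (Fin (suc m)) p} (P? : Decidable P) {a} →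
               P a → count P? ≡ suc (count (P? ∘ punchIn a))
count-remove P? {a} pa = trans (sum-remove (𝟙 ∘ P?)) (cong (_+ count (P? ∘ punchIn a)) (𝟙-holds (P? a) pa))

count-singleton : ∀ {m p} {P : Pred (Fin m) p} (P? : Decidable P) {a} →
                  P a → (∀ {b} → P b → b ≡ a) → count P? ≡ 1
count-singleton {suc m} P? {a} pa unique = begin
  count P?                      ≡⟨ count-remove P? pa ⟩
  suc (count (P? ∘ punchIn a))  ≡⟨ cong suc (count-empty (P? ∘ punchIn a) (λ v → punchInᵢ≢i a v ∘ unique)) ⟩
  1                             ∎
  where open ≡-Reasoning

count-subsingleton : ∀ {m p} {P : Pred (Fin m) p} (P? : Decidable P) →
                     (∀ {a b} → P a → P b → a ≡ b) → count P? ≤ 1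
count-subsingleton P? unique with any? P?
... | yes (a , pa) = ≤-reflexive (count-singleton P? pa (λ pb → unique pb pa))
... | no ∄a        = ≤-trans (≤-reflexive (count-empty P? (λ v pv → ∄a (v , pv)))) z≤n

1≤count : ∀ {m p} {P : Pred (Fin m) p} (P? : Decidable P) {a} → P a → 1 ≤ count P?
1≤count {suc m} P? pa rewrite count-remove P? pa = s≤s z≤n

2≤count : ∀ {m p} {P : Pred (Fin m) p} (P? : Decidable P) {a b} → P a → P b → a ≢ b → 2 ≤ count P?
2≤count {suc m} {P = P} P? {a} pa pb a≢b rewrite count-remove P? pa =
  s≤s (1≤count (P? ∘ punchIn a) (subst P (sym (punchIn-punchOut a≢b)) pb))

count-≟ : ∀ {r} (a : Fin r) → count (a ≟_) ≡ 1
count-≟ a = count-singleton (a ≟_) refl sym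

count-fibres : ∀ {m r p} {P : Pred (Fin m) p} (P? : Decidable P) (f : Fin m → Fin r) →
               ∑[ j < r ] count (λ v → P? v ×-dec f v ≟ j) ≡ count P?
count-fibres {m} {r} P? f = begin
  ∑[ j < r ] ∑[ v < m ] 𝟙 (P? v ×-dec f v ≟ j)  ≡⟨ sym (∑-comm (λ v j → 𝟙 (P? v ×-dec f v ≟ j))) ⟩
  ∑[ v < m ] ∑[ j < r ] 𝟙 (P? v ×-dec f v ≟ j)  ≡⟨ sum-cong-≗ fibre ⟩
  count P?                                       ∎
  where
  open ≡-Reasoning
  fibre : ∀ v → ∑[ j < r ] 𝟙 (P? v ×-dec f v ≟ j) ≡ 𝟙 (P? v)
  fibre v with P? v
  ... | yes _ = count-≟ (f v)
  ... | no _  = sum-replicate-zero r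

count-≤-injection : ∀ {m r p q} {P : Pred (Fin m) p} {Q : Pred (Fin r) q}
                    (P? : Decidable P) (Q? : Decidable Q) (f : Fin m → Fin r) →
                    (∀ {a b} → P a → P b → f a ≡ f b → a ≡ b) → (∀ {a} → P a → Q (f a)) →
                    count P? ≤ count Q?
count-≤-injection {r = r} P? Q? f injective maps-into = begin
  count P?                                      ≡⟨ sym (count-fibres P? f) ⟩
  ∑[ u < r ] count (λ v → P? v ×-dec f v ≟ u)   ≤⟨ ∑-mono-≤ fibre≤ ⟩
  count Q?                                      ∎
  where
  open ≤-Reasoning
  fibre≤ : ∀ u → count (λ v → P? v ×-dec f v ≟ u) ≤ 𝟙 (Q? u)
  fibre≤ u with Q? u
  ... | yes _ = count-subsingleton (λ v → P? v ×-dec f v ≟ u)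
                  (λ (pa , fa≡u) (pb , fb≡u) → injective pa pb (trans fa≡u (sym fb≡u)))
  ... | no ¬q = ≤-reflexive (count-empty (λ v → P? v ×-dec f v ≟ u) (λ { v (pv , refl) → ¬q (maps-into pv) }))

∈-tabulate-does : ∀ {m p} {P : Pred (Fin m) p} (P? : Decidable P) {v} → v ∈ tabulate (does ∘ P?) → P v
∈-tabulate-does P? {v} v∈ with P? v | trans (sym (lookup∘tabulate (does ∘ P?) v)) ([]=⇒lookup v∈)
... | yes pv | _  = pv
... | no _   | ()

∣tabulate-does∣≡count : ∀ {m p} {P : Pred (Fin m) p} (P? : Decidable P) → ∣ tabulate (does ∘ P?) ∣ ≡ count P?
∣tabulate-does∣≡count {zero}  P? = refl
∣tabulate-does∣≡count {suc m} P? with P? zero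
... | yes _ = cong suc (∣tabulate-does∣≡count (P? ∘ suc))
... | no _  = ∣tabulate-does∣≡count (P? ∘ suc)

count-fibres-all : ∀ {m r} (f : Fin m → Fin r) → ∑[ j < r ] count (λ v → f v ≟ j) ≡ m
count-fibres-all f = trans (count-fibres (λ _ → yes tt) f) (count-all (λ _ → yes tt) (λ _ → tt))

module _ {n} (G : Graph n) {ω} (ω-max : ∀ S → IsClique G S → ∣ S ∣ ≤ ω) where

  clique-count≤ω : ∀ {p} {P : Pred (Fin n) p} (P? : Decidable P) →
                   (∀ {u v} → P u → P v → u ≢ v → Adj G u v) → count P? ≤ ω
  clique-count≤ω P? clique = subst (_≤ ω) (∣tabulate-does∣≡count P?)
    (ω-max (tabulate (does ∘ P?)) (λ u v u∈ v∈ → clique (∈-tabulate-does P? u∈) (∈-tabulate-does P? v∈)))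

  embedded-clique-count≤ω : ∀ {m p} {P : Pred (Fin m) p} (P? : Decidable P) (f : Fin m → Fin n) →
                            (∀ {i j} → P i → P j → i ≢ j → Adj G (f i) (f j)) → count P? ≤ ω
  embedded-clique-count≤ω {P = P} P? f clique = begin
    count P?      ≤⟨ count-≤-injection P? Image? f injective (λ {i} pi → i , pi , refl) ⟩
    count Image?  ≤⟨ clique-count≤ω Image? image-clique ⟩
    ω             ∎
    where
    open ≤-Reasoning
    Image : Pred (Fin n) _
    Image v = ∃ λ i → P i × f i ≡ v
    Image? : Decidable Image
    Image? v = any? (λ i → P? i ×-dec f i ≟ v)
    injective : ∀ {i j} → P i → P j → f i ≡ f j → i ≡ j
    injective {i} {j} pi pj fi≡fj with i ≟ j
    ... | yes i≡j = i≡j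
    ... | no i≢j  = ⊥-elim (Graph.irrefl G (subst (Adj G (f i)) (sym fi≡fj) (clique pi pj i≢j)))
    image-clique : ∀ {u v} → Image u → Image v → u ≢ v → Adj G u v
    image-clique (i , pi , refl) (j , pj , refl) fi≢fj = clique pi pj (fi≢fj ∘ cong f)

  clique-partition-size : ∀ {k} (p : Fin n → Fin k) → (∀ u v → p u ≡ p v → u ≢ v → Adj G u v) → n ≤ k * ω
  clique-partition-size {k} p p-clique = begin
    n                                   ≡⟨ sym (count-fibres-all p) ⟩
    ∑[ ℓ < k ] count (λ v → p v ≟ ℓ)    ≤⟨ ∑-mono-≤ (λ ℓ → clique-count≤ω (λ v → p v ≟ ℓ) same-part) ⟩
    ∑[ ℓ < k ] ω                        ≡⟨ ∑-const k ω ⟩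
    k * ω                               ∎
    where
    open ≤-Reasoning
    same-part : ∀ {ℓ u v} → p u ≡ ℓ → p v ≡ ℓ → u ≢ v → Adj G u v
    same-part {u = u} {v} pu≡ℓ pv≡ℓ = p-clique u v (trans pu≡ℓ (sym pv≡ℓ))

module BVertices {n φ} (G : Graph n) (c : Fin n → Fin φ) (x : Fin φ → Fin n)
                 (c∘x : ∀ i → c (x i) ≡ i)
                 (x-dominates : ∀ i j → j ≢ i → ∃ λ w → Adj G (x i) w × c w ≡ j) where

  Nontrivial : Pred (Fin φ) 0ℓ
  Nontrivial i = ∃ λ w → c w ≡ i × w ≢ x i

  nontrivial? : Decidable Nontrivial
  nontrivial? i = any? (λ w → c w ≟ i ×-dec ¬? (w ≟ x i))

  x-injective : ∀ {i j} → x i ≡ x j → i ≡ j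
  x-injective {i} {j} xi≡xj = trans (sym (c∘x i)) (trans (cong c xi≡xj) (c∘x j))

  adj-trivial : ∀ {i j} → ¬ Nontrivial i → j ≢ i → Adj G (x j) (x i)
  adj-trivial {i} {j} trivial j≢i with x-dominates j i (j≢i ∘ sym)
  ... | w , xj~w , cw≡i with w ≟ x i
  ...   | yes refl = xj~w
  ...   | no w≢xi  = contradiction (w , cw≡i , w≢xi) trivial

  module Partition {k} (p : Fin n → Fin k) (p-clique : ∀ u v → p u ≡ p v → u ≢ v → Adj G u v) where

    CliqueColours : Fin k → Pred (Fin φ) 0ℓ
    CliqueColours ℓ i = ¬ Nontrivial i ⊎ p (x i) ≡ ℓ

    cliqueColours? : ∀ ℓ → Decidable (CliqueColours ℓ)
    cliqueColours? ℓ i = ¬? (nontrivial? i) ⊎-dec p (x i) ≟ ℓ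

    x-clique : ∀ ℓ {i j} → CliqueColours ℓ i → CliqueColours ℓ j → i ≢ j → Adj G (x i) (x j)
    x-clique ℓ (inj₁ i-trivial) _                i≢j = Graph.sym G (adj-trivial i-trivial (i≢j ∘ sym))
    x-clique ℓ (inj₂ _)         (inj₁ j-trivial) i≢j = adj-trivial j-trivial i≢j
    x-clique ℓ {i} {j} (inj₂ pxi≡ℓ) (inj₂ pxj≡ℓ) i≢j =
      p-clique (x i) (x j) (trans pxi≡ℓ (sym pxj≡ℓ)) (i≢j ∘ x-injective)

    multiplicity : Fin φ → ℕ
    multiplicity i = count (λ ℓ → cliqueColours? ℓ i)

    multiplicity-trivial : ∀ {i} → ¬ Nontrivial i → multiplicity i ≡ k
    multiplicity-trivial {i} trivial = count-all (λ ℓ → cliqueColours? ℓ i) (λ _ → inj₁ trivial)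

    multiplicity-nontrivial : ∀ {i} → Nontrivial i → multiplicity i ≡ 1
    multiplicity-nontrivial {i} nontrivial = count-singleton (λ ℓ → cliqueColours? ℓ i) (inj₂ refl) part
      where
      part : ∀ {ℓ} → CliqueColours ℓ i → ℓ ≡ p (x i)
      part (inj₁ trivial) = contradiction nontrivial trivial
      part (inj₂ pxi≡ℓ)   = sym pxi≡ℓ

    classSize : Fin φ → ℕ
    classSize i = count (λ v → c v ≟ i)

    2*k∸1≤multiplicity+[k∸1]*classSize : ∀ i → 2 * k ∸ 1 ≤ multiplicity i + (k ∸ 1) * classSize i
    2*k∸1≤multiplicity+[k∸1]*classSize i = by-cases (nontrivial? i)
      where
      open ≤-Reasoning
      by-cases : Dec (Nontrivial i) → 2 * k ∸ 1 ≤ multiplicity i + (k ∸ 1) * classSize i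
      by-cases (yes nontrivial@(w , cw≡i , w≢xi)) = begin
        2 * k ∸ 1                               ≤⟨ 2*k∸1≤1+[k∸1]*2 k ⟩
        1 + (k ∸ 1) * 2                         ≡⟨ cong (_+ (k ∸ 1) * 2) (sym (multiplicity-nontrivial nontrivial)) ⟩
        multiplicity i + (k ∸ 1) * 2            ≤⟨ +-monoʳ-≤ (multiplicity i) (*-monoʳ-≤ (k ∸ 1) two-vertices) ⟩
        multiplicity i + (k ∸ 1) * classSize i  ∎
        where
        two-vertices : 2 ≤ classSize i
        two-vertices = 2≤count (λ v → c v ≟ i) (c∘x i) cw≡i (w≢xi ∘ sym)
      by-cases (no trivial) = begin
        2 * k ∸ 1                               ≡⟨ 2*k∸1≡k+[k∸1] k ⟩
        k + (k ∸ 1)                             ≡⟨ cong₂ _+_ (sym (multiplicity-trivial trivial)) (sym (*-identityʳ (k ∸ 1))) ⟩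
        multiplicity i + (k ∸ 1) * 1            ≤⟨ +-monoʳ-≤ (multiplicity i) (*-monoʳ-≤ (k ∸ 1) one-vertex) ⟩
        multiplicity i + (k ∸ 1) * classSize i  ∎
        where
        one-vertex : 1 ≤ classSize i
        one-vertex = 1≤count (λ v → c v ≟ i) (c∘x i)

    ∑-multiplicity≤k*ω : ∀ {ω} → (∀ S → IsClique G S → ∣ S ∣ ≤ ω) → sum multiplicity ≤ k * ω
    ∑-multiplicity≤k*ω {ω} ω-max = begin
      sum multiplicity                        ≡⟨ ∑-comm (λ i ℓ → 𝟙 (cliqueColours? ℓ i)) ⟩
      ∑[ ℓ < k ] count (cliqueColours? ℓ)     ≤⟨ ∑-mono-≤ part-bound ⟩
      ∑[ ℓ < k ] ω                            ≡⟨ ∑-const k ω ⟩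
      k * ω                                   ∎
      where
      open ≤-Reasoning
      part-bound : ∀ ℓ → count (cliqueColours? ℓ) ≤ ω
      part-bound ℓ = embedded-clique-count≤ω G ω-max (cliqueColours? ℓ) x (x-clique ℓ)

    ∑-classSize≡n : sum classSize ≡ n
    ∑-classSize≡n = count-fibres-all c

theorem2 : ∀ (n : ℕ) (G : Graph n) (k ω φ : ℕ)
           → IsCliquePartitionNumber G k
           → IsCliqueNumber G ω
           → IsBChromaticNumber G φ
           → φ * (2 * k ∸ 1) ≤ k * k * ω
theorem2 n G k ω φ ((p , _ , p-clique) , _) (_ , ω-max) ((c , _ , _ , b-vertex) , _) = begin
  φ * (2 * k ∸ 1)
    ≡⟨ sym (∑-const φ (2 * k ∸ 1)) ⟩
  ∑[ i < φ ] (2 * k ∸ 1)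
    ≤⟨ ∑-mono-≤ 2*k∸1≤multiplicity+[k∸1]*classSize ⟩
  ∑[ i < φ ] (multiplicity i + (k ∸ 1) * classSize i)
    ≡⟨ ∑-distrib-+ multiplicity (λ i → (k ∸ 1) * classSize i) ⟩
  sum multiplicity + ∑[ i < φ ] ((k ∸ 1) * classSize i)
    ≡⟨ cong (sum multiplicity +_) (sym (*-distribˡ-sum (k ∸ 1) classSize)) ⟩
  sum multiplicity + (k ∸ 1) * sum classSize
    ≡⟨ cong (λ s → sum multiplicity + (k ∸ 1) * s) ∑-classSize≡n ⟩
  sum multiplicity + (k ∸ 1) * n
    ≤⟨ +-mono-≤ (∑-multiplicity≤k*ω ω-max) (*-monoʳ-≤ (k ∸ 1) n≤k*ω) ⟩
  k * ω + (k ∸ 1) * (k * ω)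
    ≡⟨ k*m+[k∸1]*[k*m]≡k*k*m k ω ⟩
  k * k * ω
    ∎
  where
  open ≤-Reasoning
  n≤k*ω : n ≤ k * ω
  n≤k*ω = clique-partition-size G ω-max p p-clique
  open BVertices G c (proj₁ ∘ b-vertex) (proj₁ ∘ proj₂ ∘ b-vertex) (λ i → proj₂ (proj₂ (b-vertex i)))
  open Partition p p-clique
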